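{- For an integer $d$, let $k=\left\lceil \frac{\log_2 1.5}{\log_2 4.5}(d-1)\right\rceil$ and $m=d-1-2k$. Let $D_0$ be the distribution on $Q^{2k+1}$ with $2^k$ pebbles on each of $\mathbf{0}^{2k+1}$ and $\mathbf{1}^{2k+1}$ and none elsewhere, and for $i\ge0$ let $D_{i+1}$ be the distribution on $Q^{2k+i+2}$ given by $D_{i+1}(\mathbf{v}\cdot0)=E_{D_i(\mathbf{v})}(x_0)$, $D_{i+1}(\mathbf{v}\cdot1)=E_{D_i(\mathbf{v})}(x_1)$ for $\mathbf{v}\in V(Q^{2k+i+1})$. Then the distribution $D_m$ on $Q^{2k+m+1}=Q^d$ satisfies, as $d\to\infty$, $|D_m|\in O(2^m)$, and $2^m\in O(c^d)$ where $c=2^{1/\log_2 4.5}\approx1.3763$.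
   Context: A distribution on a graph $G=(V,E)$ is a function $D:V\to\mathbb{N}$, with size $|D|=\sum_v D(v)$. The hypercube $Q^n$ has vertex set $\{0,1\}^n$ (bitstrings of length $n$), two bitstrings adjacent iff they differ in exactly one bit; $\mathbf{0}^n,\mathbf{1}^n$ are the all-zeros and all-ones strings and $\mathbf{v}\cdot b$ is the concatenation of $\mathbf{v}$ with the bit $b$. With $K_2$ having vertices $x_0,x_1$, for integers $j\ge0$ the distributions $E_r$ on $K_2$ are: $E_{3j}(x_0)=E_{3j}(x_1)=2j$; $E_{3j+1}(x_0)=2j+2$, $E_{3j+1}(x_1)=2j$; $E_{3j+2}(x_0)=2j+2$, $E_{3j+2}(x_1)=2j+1$. (For $d$ large, $m\ge0$.) -}

module Defs where

open import Data.Nat using (ℕ; zero; suc; _+_; _*_; _∸_; _^_; _≤_; _<_)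
open import Data.Bool using (Bool; true; false; if_then_else_; _∨_)
open import Data.Vec using (Vec; []; _∷_; init; last)
open import Data.Product using (_×_)

-- Vertices of the hypercube Q^n: bitstrings of length n (false = 0, true = 1).
Vertex : ℕ → Set
Vertex n = Vec Bool n

Distribution : ℕ → Set
Distribution n = Vertex n → ℕ

size : {n : ℕ} → Distribution n → ℕ
size {zero}  D = D []
size {suc n} D = size (λ v → D (false ∷ v)) + size (λ v → D (true ∷ v))

-- The distributions E_r on K_2; vertex x_0 ↔ false, x_1 ↔ true.
-- E_0 = (0,0), E_1 = (2,0), E_2 = (2,1), E_{r+3} = E_r + (2,2);
-- this gives exactly E_{3j} = (2j,2j), E_{3j+1} = (2j+2,2j), E_{3j+2} = (2j+2,2j+1).
E : ℕ → Bool → ℕ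
E zero false = 0
E zero true = 0
E (suc zero) false = 2
E (suc zero) true = 0
E (suc (suc zero)) false = 2
E (suc (suc zero)) true = 1
E (suc (suc (suc r))) b = 2 + E r b

allBits : {n : ℕ} → Bool → Vertex n → Bool
allBits b [] = true
allBits false (false ∷ v) = allBits false v
allBits false (true ∷ v) = false
allBits true (true ∷ v) = allBits true v
allBits true (false ∷ v) = false

D0 : (k : ℕ) → Distribution (2 * k + 1)
D0 k v = if allBits false v ∨ allBits true v then 2 ^ k else 0

step : {n : ℕ} → Distribution n → Distribution (suc n)
step D w = E (D (init w)) (last w)

Dseq : (k : ℕ) → (i : ℕ) → Distribution (i + (2 * k + 1))
Dseq k zero = D0 k
Dseq k (suc i) = step (Dseq k i)

-- k = ⌈ (log₂ 1.5 / log₂ 4.5) (d-1) ⌉, written out in exact integer arithmetic: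
-- for natural j, j ≥ α(d-1)  ⟺  4.5^j ≥ 1.5^(d-1)  ⟺  3^(d-1)·2^j ≤ 9^j·2^(d-1).
-- k is the least natural number with this property.
IsCeilK : (d k : ℕ) → Set
IsCeilK d k =
  (3 ^ (d ∸ 1) * 2 ^ k ≤ 9 ^ k * 2 ^ (d ∸ 1))
  × (∀ j → j < k → 9 ^ j * 2 ^ (d ∸ 1) < 3 ^ (d ∸ 1) * 2 ^ j)

-- One step turns r pebbles into |E_r| ≤ (4r + 2)/3, so starting from 2^k pebbles on each pole
-- |D_m| ≤ 2((4/3)^m 2^k + 2^m).  Minimality of k, used at k − 1, gives 2^k ≤ 4.5 (3/2)^m and hence
-- |D_m| ≤ 11·2^m.  With d − 1 = m + 2k the condition k ≥ α(d − 1) reads (3/2)^m ≤ 2^k, whence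
-- 9^m ≤ (2^m 2^k)^2 ≤ 2^m 2^d.  That 2k ≤ d − 1 follows from minimality too, because j ≥ α(2j + 1)
-- for every j ≥ 1.
module Submission where

open import Data.Bool using (Bool; true; false; if_then_else_; _∨_)
open import Data.Bool.Properties using (if-float)
open import Data.Nat using (ℕ; NonZero; zero; suc; _+_; _*_; _∸_; _^_; _≤_; _<_; _≤′_; z≤n; s≤s; ≤′-refl; ≤′-step)
open import Data.Nat.Properties
open import Algebra.Properties.CommutativeSemigroup +-commutativeSemigroup using (interchange)
open import Data.Nat.Tactic.RingSolver using (solve-∀)
open import Data.Product using (Σ; _×_; _,_)
open import Data.Vec using (_∷_)
open import Function.Base using (_∘_)
open import Function.Bundles using (_⇔_; mk⇔; module Equivalence)
open import Relation.Binary.PropositionalEquality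

open import Defs

^-distribʳ-* : ∀ a b n → (a * b) ^ n ≡ a ^ n * b ^ n
^-distribʳ-* a b zero    = refl
^-distribʳ-* a b (suc n) = begin
  a * b * (a * b) ^ n      ≡⟨ cong (a * b *_) (^-distribʳ-* a b n) ⟩
  a * b * (a ^ n * b ^ n)  ≡⟨ regroup a b (a ^ n) (b ^ n) ⟩
  a * a ^ n * (b * b ^ n)  ∎
  where
  open ≡-Reasoning
  regroup : ∀ a b x y → a * b * (x * y) ≡ a * x * (b * y)
  regroup = solve-∀

^-+-double : ∀ a m n → a ^ (m + 2 * n) ≡ a ^ m * (a ^ n * a ^ n)
^-+-double a m n = begin
  a ^ (m + 2 * n)                ≡⟨ ^-distribˡ-+-* a m (2 * n) ⟩
  a ^ m * a ^ (n + (n + 0))      ≡⟨ cong (a ^ m *_) (^-distribˡ-+-* a n (n + 0)) ⟩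
  a ^ m * (a ^ n * a ^ (n + 0))  ≡⟨ cong (λ o → a ^ m * (a ^ n * a ^ o)) (+-identityʳ n) ⟩
  a ^ m * (a ^ n * a ^ n)        ∎
  where open ≡-Reasoning

size-cong : ∀ {n} {D D′ : Distribution n} → (∀ v → D v ≡ D′ v) → size D ≡ size D′
size-cong {zero}  eq = eq _
size-cong {suc n} eq = cong₂ _+_ (size-cong (λ v → eq (false ∷ v))) (size-cong (λ v → eq (true ∷ v)))

size-mono : ∀ {n} {D D′ : Distribution n} → (∀ v → D v ≤ D′ v) → size D ≤ size D′
size-mono {zero}  le = le _
size-mono {suc n} le = +-mono-≤ (size-mono (λ v → le (false ∷ v))) (size-mono (λ v → le (true ∷ v)))

size-+ : ∀ {n} (D D′ : Distribution n) → size (λ v → D v + D′ v) ≡ size D + size D′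
size-+ {zero}  D D′ = refl
size-+ {suc n} D D′ =
  trans (cong₂ _+_ (size-+ {n} _ _) (size-+ {n} _ _)) (interchange (half D false) (half D′ false) (half D true) (half D′ true))
  where
  half : Distribution (suc n) → Bool → ℕ
  half F b = size (λ v → F (b ∷ v))

size-zero : ∀ {n} → size {n} (λ _ → 0) ≡ 0
size-zero {zero}  = refl
size-zero {suc n} = cong₂ _+_ (size-zero {n}) (size-zero {n})

size-pole : ∀ {n} b c → size {n} (λ v → if allBits b v then c else 0) ≡ c
size-pole {zero}  b     c = refl
size-pole {suc n} false c = trans (cong₂ _+_ (size-pole {n} false c) (size-zero {n})) (+-identityʳ c)
size-pole {suc n} true  c = cong₂ _+_ (size-zero {n}) (size-pole {n} true c)

size-poles-≤ : ∀ {n} c → size {n} (λ v → if allBits false v ∨ allBits true v then c else 0) ≤ 2 * c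
size-poles-≤ {n} c = begin
  size {n} (λ v → if allBits false v ∨ allBits true v then c else 0)
    ≤⟨ size-mono {n} (λ v → or-≤ (allBits false v) (allBits true v)) ⟩
  size {n} (λ v → pole false v + pole true v)
    ≡⟨ size-+ (pole false) (pole true) ⟩
  size (pole false) + size (pole true)
    ≡⟨ cong₂ _+_ (size-pole {n} false c) (trans (size-pole {n} true c) (sym (+-identityʳ c))) ⟩
  2 * c ∎
  where
  open ≤-Reasoning
  pole : Bool → Distribution n
  pole b v = if allBits b v then c else 0
  or-≤ : ∀ a b → (if a ∨ b then c else 0) ≤ (if a then c else 0) + (if b then c else 0)
  or-≤ true  b = m≤m+n c _
  or-≤ false b = ≤-refl

size-step : ∀ {n} (D : Distribution n) (g : ℕ → ℕ) →
            size (λ w → g (step D w)) ≡ size (λ v → g (E (D v) false) + g (E (D v) true))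
size-step {zero}  D g = refl
size-step {suc n} D g = cong₂ _+_ (size-step (λ v → D (false ∷ v)) g) (size-step (λ v → D (true ∷ v)) g)

-- The size after i steps of the construction when it starts from r pebbles on a single vertex.
pebbles : ℕ → ℕ → ℕ
pebbles zero    r = r
pebbles (suc i) r = pebbles i (E r false) + pebbles i (E r true)

pebbles-zero : ∀ i → pebbles i 0 ≡ 0
pebbles-zero zero    = refl
pebbles-zero (suc i) = cong₂ _+_ (pebbles-zero i) (pebbles-zero i)

size-Dseq-pebbles : ∀ k i j → size (λ w → pebbles j (Dseq k i w)) ≡ size (λ v → pebbles (i + j) (D0 k v))
size-Dseq-pebbles k zero    j = refl
size-Dseq-pebbles k (suc i) j = begin
  size (λ w → pebbles j (step (Dseq k i) w))       ≡⟨ size-step (Dseq k i) (pebbles j) ⟩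
  size (λ v → pebbles (suc j) (Dseq k i v))        ≡⟨ size-Dseq-pebbles k i (suc j) ⟩
  size (λ v → pebbles (i + suc j) (D0 k v))        ≡⟨ cong (λ n → size (λ v → pebbles n (D0 k v))) (+-suc i j) ⟩
  size (λ v → pebbles (suc i + j) (D0 k v))        ∎
  where open ≡-Reasoning

size-Dseq-≤ : ∀ k m → size (Dseq k m) ≤ 2 * pebbles m (2 ^ k)
size-Dseq-≤ k m = begin
  size (Dseq k m)                          ≡⟨ size-Dseq-pebbles k m 0 ⟩
  size (λ v → pebbles (m + 0) (D0 k v))    ≡⟨ size-cong (λ v → pebbles-D0 v) ⟩
  size {2 * k + 1} (λ v → if allBits false v ∨ allBits true v then pebbles m (2 ^ k) else 0)
                                           ≤⟨ size-poles-≤ {2 * k + 1} (pebbles m (2 ^ k)) ⟩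
  2 * pebbles m (2 ^ k)                    ∎
  where
  open ≤-Reasoning
  pebbles-D0 : ∀ v → pebbles (m + 0) (D0 k v) ≡ (if allBits false v ∨ allBits true v then pebbles m (2 ^ k) else 0)
  pebbles-D0 v = trans (cong (λ i → pebbles i (D0 k v)) (+-identityʳ m))
                 (trans (if-float (pebbles m) poles) (cong (if poles then pebbles m (2 ^ k) else_) (pebbles-zero m)))
    where
    poles : Bool
    poles = allBits false v ∨ allBits true v

E-size : ∀ r → 3 * (E r false + E r true) ≤ 4 * r + 2
E-size zero                   = z≤n
E-size (suc zero)             = ≤-refl
E-size (suc (suc zero))       = n≤1+n 9
E-size (suc (suc (suc r)))    = begin
  3 * ((2 + E r false) + (2 + E r true))  ≡⟨ regroup (E r false) (E r true) ⟩
  12 + 3 * (E r false + E r true)         ≤⟨ +-monoʳ-≤ 12 (E-size r) ⟩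
  12 + (4 * r + 2)                        ≡⟨ unfold r ⟩
  4 * (3 + r) + 2                         ∎
  where
  open ≤-Reasoning
  regroup : ∀ a b → 3 * ((2 + a) + (2 + b)) ≡ 12 + 3 * (a + b)
  regroup = solve-∀
  unfold : ∀ r → 12 + (4 * r + 2) ≡ 4 * (3 + r) + 2
  unfold = solve-∀

-- In rational form, pebbles i r ≤ (4/3)^i r + 2^i − (4/3)^i.
pebbles-bound : ∀ i r → 3 ^ i * pebbles i r + 4 ^ i ≤ r * 4 ^ i + 6 ^ i
pebbles-bound zero    r = ≤-reflexive (cong (_+ 1) (trans (+-identityʳ r) (sym (*-identityʳ r))))
pebbles-bound (suc i) r = +-cancelˡ-≤ (2 * 4 ^ i) _ _ (begin
  2 * P + (3 * X * (pebbles i a + pebbles i b) + 4 * P)  ≡⟨ regroup P X (pebbles i a) (pebbles i b) ⟩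
  3 * ((X * pebbles i a + P) + (X * pebbles i b + P))    ≤⟨ *-monoʳ-≤ 3 (+-mono-≤ (pebbles-bound i a) (pebbles-bound i b)) ⟩
  3 * ((a * P + Q) + (b * P + Q))                        ≡⟨ collect a b P Q ⟩
  3 * (a + b) * P + 6 * Q                                ≤⟨ +-monoˡ-≤ (6 * Q) (*-monoˡ-≤ P (E-size r)) ⟩
  (4 * r + 2) * P + 6 * Q                                ≡⟨ spread r P Q ⟩
  2 * P + (r * (4 * P) + 6 * Q)                          ∎)
  where
  open ≤-Reasoning
  a b X P Q : ℕ
  a = E r false
  b = E r true
  X = 3 ^ i
  P = 4 ^ i
  Q = 6 ^ i
  regroup : ∀ p x u v → 2 * p + (3 * x * (u + v) + 4 * p) ≡ 3 * ((x * u + p) + (x * v + p))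
  regroup = solve-∀
  collect : ∀ a b p q → 3 * ((a * p + q) + (b * p + q)) ≡ 3 * (a + b) * p + 6 * q
  collect = solve-∀
  spread : ∀ r p q → (4 * r + 2) * p + 6 * q ≡ 2 * p + (r * (4 * p) + 6 * q)
  spread = solve-∀

pebbles-budget : ∀ m r → 2 * r * 2 ^ m ≤ 9 * 3 ^ m → 2 * pebbles m r ≤ 11 * 2 ^ m
pebbles-budget m r budget = *-cancelˡ-≤ (3 ^ m) {{m^n≢0 3 m}} (begin
  3 ^ m * (2 * pebbles m r)                 ≤⟨ m≤m+n _ (2 * 4 ^ m) ⟩
  3 ^ m * (2 * pebbles m r) + 2 * 4 ^ m     ≡⟨ double (3 ^ m) (pebbles m r) (4 ^ m) ⟩
  2 * (3 ^ m * pebbles m r + 4 ^ m)         ≤⟨ *-monoʳ-≤ 2 (pebbles-bound m r) ⟩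
  2 * (r * 4 ^ m + 6 ^ m)                   ≡⟨ cong₂ (λ x y → 2 * (r * x + y)) (^-distribʳ-* 2 2 m) (^-distribʳ-* 3 2 m) ⟩
  2 * (r * (2 ^ m * 2 ^ m) + 3 ^ m * 2 ^ m) ≡⟨ regroup r (2 ^ m) (3 ^ m) ⟩
  2 * r * 2 ^ m * 2 ^ m + 2 * 3 ^ m * 2 ^ m ≤⟨ +-monoˡ-≤ _ (*-monoˡ-≤ (2 ^ m) budget) ⟩
  9 * 3 ^ m * 2 ^ m + 2 * 3 ^ m * 2 ^ m     ≡⟨ collect (3 ^ m) (2 ^ m) ⟩
  3 ^ m * (11 * 2 ^ m)                      ∎)
  where
  open ≤-Reasoning
  double : ∀ x p q → x * (2 * p) + 2 * q ≡ 2 * (x * p + q)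
  double = solve-∀
  regroup : ∀ r t x → 2 * (r * (t * t) + x * t) ≡ 2 * r * t * t + 2 * x * t
  regroup = solve-∀
  collect : ∀ x t → 9 * x * t + 2 * x * t ≡ x * (11 * t)
  collect = solve-∀

-- j ≥α e  says  j ≥ α e  for  α = log 1.5 / log 4.5,  i.e.  4.5^j ≥ 1.5^e.
_≥α_ : ℕ → ℕ → Set
j ≥α e = 3 ^ e * 2 ^ j ≤ 9 ^ j * 2 ^ e

_<α_ : ℕ → ℕ → Set
j <α e = 9 ^ j * 2 ^ e < 3 ^ e * 2 ^ j

-- Both sides of  j ≥α (m + 2j)  carry the common factor 9^j 2^j.
≥α-shift : ∀ j m → j ≥α (m + 2 * j) ⇔ 3 ^ m ≤ 2 ^ m * 2 ^ j
≥α-shift j m = mk⇔ (λ h → *-cancelˡ-≤ c (subst₂ _≤_ lhs rhs h))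
                   (λ h → subst₂ _≤_ (sym lhs) (sym rhs) (*-monoʳ-≤ c h))
  where
  A B c : ℕ
  A = 3 ^ j
  B = 2 ^ j
  c = A * A * B
  instance
    c≢0 : NonZero c
    c≢0 = m*n≢0 (A * A) B {{m*n≢0 A A {{m^n≢0 3 j}} {{m^n≢0 3 j}}}} {{m^n≢0 2 j}}
  lhs : 3 ^ (m + 2 * j) * B ≡ c * 3 ^ m
  lhs = begin
    3 ^ (m + 2 * j) * B      ≡⟨ cong (_* B) (^-+-double 3 m j) ⟩
    3 ^ m * (A * A) * B      ≡⟨ regroup (3 ^ m) A B ⟩
    c * 3 ^ m                ∎
    where
    open ≡-Reasoning
    regroup : ∀ x a b → x * (a * a) * b ≡ a * a * b * x
    regroup = solve-∀
  rhs : 9 ^ j * 2 ^ (m + 2 * j) ≡ c * (2 ^ m * B)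
  rhs = begin
    9 ^ j * 2 ^ (m + 2 * j)     ≡⟨ cong₂ _*_ (^-distribʳ-* 3 3 j) (^-+-double 2 m j) ⟩
    A * A * (2 ^ m * (B * B))   ≡⟨ regroup (A * A) (2 ^ m) B ⟩
    c * (2 ^ m * B)             ∎
    where
    open ≡-Reasoning
    regroup : ∀ a t b → a * (t * (b * b)) ≡ a * b * (t * b)
    regroup = solve-∀

≥α-pred : ∀ j {e} → j ≥α suc e → j ≥α e
≥α-pred j {e} h = *-cancelˡ-≤ 2 (begin
  2 * (3 ^ e * 2 ^ j)     ≤⟨ *-monoˡ-≤ (3 ^ e * 2 ^ j) (n≤1+n 2) ⟩
  3 * (3 ^ e * 2 ^ j)     ≡⟨ *-assoc 3 (3 ^ e) (2 ^ j) ⟨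
  3 ^ suc e * 2 ^ j       ≤⟨ h ⟩
  9 ^ j * (2 * 2 ^ e)     ≡⟨ swap (9 ^ j) (2 ^ e) ⟩
  2 * (9 ^ j * 2 ^ e)     ∎)
  where
  open ≤-Reasoning
  swap : ∀ a x → a * (2 * x) ≡ 2 * (a * x)
  swap = solve-∀

≥α-antitone : ∀ j {e e′} → e ≤ e′ → j ≥α e′ → j ≥α e
≥α-antitone j = go ∘ ≤⇒≤′
  where
  go : ∀ {e e′} → e ≤′ e′ → j ≥α e′ → j ≥α e
  go ≤′-refl                      h = h
  go {e′ = suc e′} (≤′-step le) h = go le (≥α-pred j {e′} h)

≥α-odd : ∀ i → suc i ≥α (1 + 2 * suc i)
≥α-odd i = Equivalence.from (≥α-shift (suc i) 1) (≤-trans (n≤1+n 3) (*-monoʳ-≤ 2 (*-monoʳ-≤ 2 (m^n>0 2 i))))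

≥α-square : ∀ j m → j ≥α (m + 2 * j) → 9 ^ m ≤ 2 ^ m * 2 ^ (m + 2 * j)
≥α-square j m h = begin
  9 ^ m                                 ≡⟨ ^-distribʳ-* 3 3 m ⟩
  3 ^ m * 3 ^ m                         ≤⟨ *-mono-≤ 3^m≤ 3^m≤ ⟩
  (2 ^ m * 2 ^ j) * (2 ^ m * 2 ^ j)     ≡⟨ regroup (2 ^ m) (2 ^ j) ⟩
  2 ^ m * (2 ^ m * (2 ^ j * 2 ^ j))     ≡⟨ cong (2 ^ m *_) (^-+-double 2 m j) ⟨
  2 ^ m * 2 ^ (m + 2 * j)               ∎
  where
  open ≤-Reasoning
  3^m≤ : 3 ^ m ≤ 2 ^ m * 2 ^ j
  3^m≤ = Equivalence.to (≥α-shift j m) h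
  regroup : ∀ t b → (t * b) * (t * b) ≡ t * (t * (b * b))
  regroup = solve-∀

ceiling-double-≤ : ∀ k {e} → 2 ≤ e → (∀ j → j < k → j <α e) → 2 * k ≤ e
ceiling-double-≤ zero          _   _     = z≤n
ceiling-double-≤ (suc zero)    2≤e _     = 2≤e
ceiling-double-≤ (suc (suc i)) {e} _ below =
  subst (_≤ e) (sym (*-suc 2 (suc i)))
        (≰⇒> (λ e≤ → <⇒≱ (below (suc i) (n<1+n (suc i))) (≥α-antitone (suc i) e≤ (≥α-odd i))))

ceiling-budget : ∀ k m → (∀ j → j < k → j <α (m + 2 * k)) → 2 * 2 ^ k * 2 ^ m ≤ 9 * 3 ^ m
ceiling-budget zero    m _     = *-mono-≤ (m≤m+n 2 7) (^-monoˡ-≤ m (n≤1+n 2))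
ceiling-budget (suc j) m below =
  subst₂ _≤_ (swap (2 ^ m) (2 ^ j)) (nine (3 ^ m)) (<⇒≤ (≰⇒> (<⇒≱ below′ ∘ Equivalence.from (≥α-shift j (2 + m)))))
  where
  shift : ∀ m j → m + 2 * suc j ≡ 2 + m + 2 * j
  shift = solve-∀
  below′ : j <α (2 + m + 2 * j)
  below′ = subst (j <α_) (shift m j) (below j (n<1+n j))
  swap : ∀ x y → 2 * (2 * x) * y ≡ 2 * (2 * y) * x
  swap = solve-∀
  nine : ∀ x → 3 * (3 * x) ≡ 9 * x
  nine = solve-∀

theorem6p7 : Σ ℕ λ N → Σ ℕ λ C → (d k : ℕ) → N ≤ d → IsCeilK d k →
    let m = d ∸ (1 + 2 * k) in
    (2 * k + 1 ≤ d)
    × (size (Dseq k m) ≤ C * 2 ^ m)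
    × (9 ^ m ≤ C * 2 ^ m * 2 ^ d)
theorem6p7 = 3 , 11 , bounds
  where
  bounds : (d k : ℕ) → 3 ≤ d → IsCeilK d k →
    let m = d ∸ (1 + 2 * k) in
    (2 * k + 1 ≤ d) × (size (Dseq k m) ≤ 11 * 2 ^ m) × (9 ^ m ≤ 11 * 2 ^ m * 2 ^ d)
  bounds (suc e) k (s≤s 2≤e) (k≥αe , below) =
    subst (_≤ suc e) (+-comm 1 (2 * k)) (s≤s 2k≤e) , size-bound , nine-bound
    where
    2k≤e : 2 * k ≤ e
    2k≤e = ceiling-double-≤ k 2≤e below
    m : ℕ
    m = e ∸ 2 * k
    m+2k≡e : m + 2 * k ≡ e
    m+2k≡e = m∸n+n≡m 2k≤e
    size-bound : size (Dseq k m) ≤ 11 * 2 ^ m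
    size-bound = ≤-trans (size-Dseq-≤ k m)
      (pebbles-budget m (2 ^ k) (ceiling-budget k m (subst (λ x → ∀ j → j < k → j <α x) (sym m+2k≡e) below)))
    nine-bound : 9 ^ m ≤ 11 * 2 ^ m * 2 ^ suc e
    nine-bound = begin
      9 ^ m                    ≤⟨ ≥α-square k m (subst (k ≥α_) (sym m+2k≡e) k≥αe) ⟩
      2 ^ m * 2 ^ (m + 2 * k)  ≡⟨ cong (λ x → 2 ^ m * 2 ^ x) m+2k≡e ⟩
      2 ^ m * 2 ^ e            ≤⟨ *-monoʳ-≤ (2 ^ m) (^-monoʳ-≤ 2 (n≤1+n e)) ⟩
      2 ^ m * 2 ^ suc e        ≤⟨ *-monoˡ-≤ (2 ^ suc e) (m≤n*m (2 ^ m) 11) ⟩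
      11 * 2 ^ m * 2 ^ suc e   ∎
      where open ≤-Reasoning
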